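{- Let $X$ be a $d$-dimensional simplicial complex ($d\ge1$) on a vertex set $V$ with $|V|=n$, and let $\tau\in X^{d-2}$. Then \[h(X)\le\frac{h(\operatorname{lk}\tau)}{1-\frac{d-1}{n}}.\]
   Context: $X^j$ is the set of $j$-cells of $X$ (cells with $j+1$ vertices), $X^{ -1}=\{\varnothing\}$. For disjoint $A_0,\dots,A_d\subseteq V$, $F(A_0,\dots,A_d)$ is the set of $d$-cells with exactly one vertex in each $A_i$, and $h(X)=\min\frac{n\,|F(A_0,\dots,A_d)|}{|A_0|\cdots|A_d|}$ over all partitions $V=A_0\sqcup\dots\sqcup A_d$ into nonempty sets. The link of $\tau$ is $\operatorname{lk}\tau=\{\sigma\in X:\sigma\cap\tau=\varnothing,\ \sigma\cup\tau\in X\}$; since $\dim\tau=d-2$ it is a graph, with vertex set $(\operatorname{lk}\tau)^0$. For a graph $G$ with vertex set $W$, $h(G)=\min\frac{|W|\cdot|E(B,C)|}{|B|\cdot|C|}$ over partitions $W=B\sqcup C$ into nonempty sets, where $E(B,C)$ is the set of edges with one endpoint in $B$ and one in $C$. -}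

module Defs where

open import Data.Nat using (ℕ; zero; suc; _≡ᵇ_; _≤_)
import Data.Nat as ℕ
open import Data.Bool using (Bool; true; false; T; _∧_; not)
open import Data.Fin using (Fin)
open import Data.Fin.Subset using (Subset; _⊆_; _∩_; _∪_; ∣_∣; ⁅_⁆; ⊥; _∈_; Nonempty; Empty)
open import Data.Vec using ([]; _∷_; lookup; tabulate)
open import Data.List using (List; [_]; _++_; map; length; filterᵇ; allFin)
open import Data.Bool.ListAction using (all)
open import Data.Nat.ListAction using (product)
open import Data.Product using (Σ; ∃; _×_; _,_)
open import Data.Integer using (+_)
open import Data.Rational using (ℚ) renaming (_/_ to _/ℚ_)
import Data.Rational as ℚ
open import Relation.Binary.PropositionalEquality using (_≡_; _≢_)

ℚ[_] : ℕ → ℚ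
ℚ[ m ] = (+ m) /ℚ 1

allSubsets : (n : ℕ) → List (Subset n)
allSubsets zero = [ [] ]
allSubsets (suc n) = map (true ∷_) (allSubsets n) ++ map (false ∷_) (allSubsets n)

count : ∀ {n} → (Subset n → Bool) → ℕ
count {n} p = length (filterᵇ p (allSubsets n))

record SimplicialComplex (n : ℕ) : Set where
  field
    cell        : Subset n → Bool
    empty-cell  : T (cell ⊥)
    vertex-cell : ∀ (v : Fin n) → T (cell ⁅ v ⁆)
    down-closed : ∀ (σ ρ : Subset n) → ρ ⊆ σ → T (cell σ) → T (cell ρ)
open SimplicialComplex public

-- X is d-dimensional: it has a d-cell (d+1 vertices) and no larger cell
Dimension : ∀ {n} → SimplicialComplex n → ℕ → Set
Dimension {n} X d =
  (∃ λ (σ : Subset n) → T (cell X σ) × ∣ σ ∣ ≡ suc d)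
  × (∀ (σ : Subset n) → T (cell X σ) → ∣ σ ∣ ≤ suc d)

IsPartition : ∀ {n} (d : ℕ) → (Fin (suc d) → Subset n) → Set
IsPartition {n} d A =
  (∀ i → Nonempty (A i))
  × (∀ i j → i ≢ j → Empty (A i ∩ A j))
  × (∀ (v : Fin n) → ∃ λ i → v ∈ A i)

numF : ∀ {n} → SimplicialComplex n → (d : ℕ) → (Fin (suc d) → Subset n) → ℕ
numF X d A = count (λ σ → cell X σ ∧ (∣ σ ∣ ≡ᵇ suc d)
                          ∧ all (λ i → ∣ σ ∩ A i ∣ ≡ᵇ 1) (allFin (suc d)))

prodSizes : ∀ {n} (d : ℕ) → (Fin (suc d) → Subset n) → ℕ
prodSizes d A = product (map (λ i → ∣ A i ∣) (allFin (suc d)))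

-- r = h(X): r = n|F(A)|/(|A_0|⋯|A_d|) for some partition and r is ≤ that ratio
-- for every partition (the denominators are positive, so we clear them)
IsCheegerX : ∀ {n} → SimplicialComplex n → (d : ℕ) → ℚ → Set
IsCheegerX {n} X d r =
  (∃ λ A → IsPartition d A × (r ℚ.* ℚ[ prodSizes d A ] ≡ ℚ[ n ℕ.* numF X d A ]))
  × (∀ A → IsPartition d A → r ℚ.* ℚ[ prodSizes d A ] ℚ.≤ ℚ[ n ℕ.* numF X d A ])

linkVertices : ∀ {n} → SimplicialComplex n → Subset n → Subset n
linkVertices X τ = tabulate (λ v → not (lookup τ v) ∧ cell X (τ ∪ ⁅ v ⁆))

isLinkEdge : ∀ {n} → SimplicialComplex n → Subset n → Subset n → Bool
isLinkEdge X τ e = (∣ e ∣ ≡ᵇ 2) ∧ (∣ e ∩ τ ∣ ≡ᵇ 0) ∧ cell X (τ ∪ e)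

IsGraphPartition : ∀ {n} → Subset n → Subset n → Subset n → Set
IsGraphPartition W B C = Nonempty B × Nonempty C × Empty (B ∩ C) × (B ∪ C ≡ W)

numE : ∀ {n} → SimplicialComplex n → Subset n → Subset n → Subset n → ℕ
numE X τ B C = count (λ e → isLinkEdge X τ e ∧ (∣ e ∩ B ∣ ≡ᵇ 1) ∧ (∣ e ∩ C ∣ ≡ᵇ 1))

IsCheegerLink : ∀ {n} → SimplicialComplex n → Subset n → ℚ → Set
IsCheegerLink X τ r =
  (∃ λ B → ∃ λ C → IsGraphPartition W B C
      × (r ℚ.* ℚ[ ∣ B ∣ ℕ.* ∣ C ∣ ] ≡ ℚ[ ∣ W ∣ ℕ.* numE X τ B C ]))
  × (∀ B C → IsGraphPartition W B C
      → r ℚ.* ℚ[ ∣ B ∣ ℕ.* ∣ C ∣ ] ℚ.≤ ℚ[ ∣ W ∣ ℕ.* numE X τ B C ])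
  where W = linkVertices X τ

module Submission where

-- Take a cut W = B ⊔ C of the link vertices W of τ attaining h(lk τ), and write
-- k = d - 1 = |τ|. Split V into d+1 parts: A₀ = C, A₁ = V ∖ (C ∪ τ) ⊇ B, and one singleton
-- part for each of the k vertices of τ. A d-cell with one vertex in each part contains τ,
-- and σ ↦ σ ∖ τ maps such cells injectively to edges of lk τ joining B and C, so
-- |F(A)| ≤ |E(B,C)|. As |A₀|⋯|A_d| = |C|·|A₁|, |B| ≤ |A₁| and |A₁| + |C| = n - k,
--   h(X)·(n-k) ≤ n·|F(A)|·(n-k)/(|C|·|A₁|) ≤ n·|E(B,C)|·(|B|+|C|)/(|B|·|C|) = n·h(lk τ).

open import Defs
open import Data.Nat using (ℕ)
open import Data.Fin.Subset using (Subset; ∣_∣; _∪_; _∩_; Empty)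
open import Relation.Binary.PropositionalEquality using (_≡_)

module SubsetAlgebra where

  open import Data.Nat using (suc; _+_; _≤_)
  open import Data.Nat.Properties using (+-suc)
  open import Data.Bool using (true; false; _∧_; _∨_; _xor_)
  open import Data.Bool.Properties using (∧-zeroʳ)
  open import Data.Fin using (Fin; zero; suc)
  open import Data.Fin.Subset using (Subset; ∣_∣; _∪_; _∩_; ⁅_⁆; ⊥; _∈_; _⊆_; Nonempty)
  open import Data.Fin.Subset.Properties using (∣⊥∣≡0; ∣⁅x⁆∣≡1; x∈⁅x⁆; x∈⁅y⁆⇒x≡y; p⊆q⇒∣p∣≤∣q∣)
  open import Data.Vec using ([]; _∷_; lookup; zipWith)
  open import Data.Vec.Properties using (tabulate∘lookup; tabulate-cong; lookup-zipWith; lookup-replicate; []=⇒lookup; lookup⇒[]=)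
  open import Data.Product using (_×_; _,_)
  open import Relation.Nullary using (contradiction)
  open import Relation.Binary.PropositionalEquality

  -- symmetric difference; s ↦ s ⊕ τ is an involution of the subsets of Fin n
  _⊕_ : ∀ {n} → Subset n → Subset n → Subset n
  s ⊕ τ = zipWith _xor_ s τ

  lookup-∩ : ∀ {n} (p q : Subset n) u → lookup (p ∩ q) u ≡ lookup p u ∧ lookup q u
  lookup-∩ p q u = lookup-zipWith _∧_ u p q

  lookup-∪ : ∀ {n} (p q : Subset n) u → lookup (p ∪ q) u ≡ lookup p u ∨ lookup q u
  lookup-∪ p q u = lookup-zipWith _∨_ u p q

  lookup-⊕ : ∀ {n} (p q : Subset n) u → lookup (p ⊕ q) u ≡ lookup p u xor lookup q u
  lookup-⊕ p q u = lookup-zipWith _xor_ u p q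

  subset-ext : ∀ {n} (p q : Subset n) → (∀ u → lookup p u ≡ lookup q u) → p ≡ q
  subset-ext p q same =
    trans (sym (tabulate∘lookup p)) (trans (tabulate-cong same) (tabulate∘lookup q))

  ⊆-from-lookup : ∀ {n} {p q : Subset n} → (∀ u → lookup p u ≡ true → lookup q u ≡ true) → p ⊆ q
  ⊆-from-lookup {q = q} p⇒q {u} u∈p = lookup⇒[]= u q (p⇒q u ([]=⇒lookup u∈p))

  Disjoint : ∀ {n} → Subset n → Subset n → Set
  Disjoint p q = ∀ u → lookup p u ≡ true → lookup q u ≡ false

  disjoint-sym : ∀ {n} (p q : Subset n) → Disjoint p q → Disjoint q p
  disjoint-sym p q disj u qu with lookup p u in pu
  ... | false = refl
  ... | true  = trans (sym qu) (disj u pu)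

  card-disjoint-∪ : ∀ {n} (p q : Subset n) → Disjoint p q → ∣ p ∪ q ∣ ≡ ∣ p ∣ + ∣ q ∣
  card-disjoint-∪ [] [] _ = refl
  card-disjoint-∪ (true ∷ p) (true ∷ q) disj with disj zero refl
  ... | ()
  card-disjoint-∪ (true ∷ p) (false ∷ q) disj = cong suc (card-disjoint-∪ p q (λ u → disj (suc u)))
  card-disjoint-∪ (false ∷ p) (true ∷ q) disj =
    trans (cong suc (card-disjoint-∪ p q (λ u → disj (suc u)))) (sym (+-suc ∣ p ∣ ∣ q ∣))
  card-disjoint-∪ (false ∷ p) (false ∷ q) disj = card-disjoint-∪ p q (λ u → disj (suc u))

  disjoint-∩-empty : ∀ {n} (p q : Subset n) → Disjoint p q → ∣ q ∩ p ∣ ≡ 0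
  disjoint-∩-empty {n} p q disj = trans (cong ∣_∣ (subset-ext (q ∩ p) ⊥ pointwise)) (∣⊥∣≡0 n)
    where
    pointwise : ∀ u → lookup (q ∩ p) u ≡ lookup ⊥ u
    pointwise u rewrite lookup-∩ q p u | lookup-replicate u false with lookup p u in pu
    ... | true  = cong (_∧ true) (disj u pu)
    ... | false = ∧-zeroʳ (lookup q u)

  singleton-ext : ∀ {n} (p : Subset n) (v : Fin n) → lookup p v ≡ true
    → (∀ u → lookup p u ≡ true → u ≡ v) → p ≡ ⁅ v ⁆
  singleton-ext p v v∈p only-v = subset-ext p ⁅ v ⁆ pointwise
    where
    pointwise : ∀ u → lookup p u ≡ lookup ⁅ v ⁆ u
    pointwise u with lookup p u in pu | lookup ⁅ v ⁆ u in su
    ... | true  | true  = refl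
    ... | false | false = refl
    ... | true  | false with only-v u pu
    ... | refl = trans (sym ([]=⇒lookup (x∈⁅x⁆ v))) su
    pointwise u | false | true with x∈⁅y⁆⇒x≡y v (lookup⇒[]= u ⁅ v ⁆ su)
    ... | refl = trans (sym pu) v∈p

  meets-singleton : ∀ {n} (p : Subset n) (v : Fin n) → ∣ p ∩ ⁅ v ⁆ ∣ ≡ 1 → lookup p v ≡ true
  meets-singleton p v size with lookup p v in pv
  ... | true  = refl
  ... | false = contradiction (trans (sym size) (disjoint-∩-empty ⁅ v ⁆ p v∉p)) λ ()
    where
    v∉p : Disjoint ⁅ v ⁆ p
    v∉p u u∈⁅v⁆ with x∈⁅y⁆⇒x≡y v (lookup⇒[]= u ⁅ v ⁆ u∈⁅v⁆)
    ... | refl = pv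

  nonempty⇒card≥1 : ∀ {n} (p : Subset n) → Nonempty p → 1 ≤ ∣ p ∣
  nonempty⇒card≥1 p (v , v∈p) = subst (_≤ ∣ p ∣) (∣⁅x⁆∣≡1 v)
    (p⊆q⇒∣p∣≤∣q∣ λ u∈⁅v⁆ → subst (_∈ p) (sym (x∈⁅y⁆⇒x≡y v u∈⁅v⁆)) v∈p)

  ⊕-decompose : ∀ {n} (e τ : Subset n) → (∀ u → lookup τ u ≡ true → lookup (e ⊕ τ) u ≡ true)
    → Disjoint τ e × e ⊕ τ ≡ τ ∪ e
  ⊕-decompose e τ τ⊆e⊕τ = τ-avoids-e , subset-ext (e ⊕ τ) (τ ∪ e) pointwise
    where
    τ-avoids-e : Disjoint τ e
    τ-avoids-e u τu with lookup e u in eu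
    ... | false = refl
    ... | true = trans (sym (τ⊆e⊕τ u τu)) (trans (lookup-⊕ e τ u) (cong₂ _xor_ eu τu))
    pointwise : ∀ u → lookup (e ⊕ τ) u ≡ lookup (τ ∪ e) u
    pointwise u rewrite lookup-∪ τ e u with lookup τ u in τu
    ... | true  = τ⊆e⊕τ u τu
    ... | false = trans (lookup-⊕ e τ u) (trans (cong (lookup e u xor_) τu) (xor-false (lookup e u)))
      where
      xor-false : ∀ b → b xor false ≡ b
      xor-false true  = refl
      xor-false false = refl

  ∩-cong-on : ∀ {n} (e y z : Subset n) → (∀ u → lookup e u ≡ true → lookup y u ≡ lookup z u)
    → e ∩ y ≡ e ∩ z
  ∩-cong-on e y z agree = subset-ext (e ∩ y) (e ∩ z) pointwise
    where
    pointwise : ∀ u → lookup (e ∩ y) u ≡ lookup (e ∩ z) u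
    pointwise u rewrite lookup-∩ e y u | lookup-∩ e z u with lookup e u in eu
    ... | true  = agree u eu
    ... | false = refl

  ∪-∩-drop : ∀ {n} (τ e y : Subset n) → Disjoint τ y → (τ ∪ e) ∩ y ≡ e ∩ y
  ∪-∩-drop τ e y τ-avoids-y = subset-ext ((τ ∪ e) ∩ y) (e ∩ y) pointwise
    where
    pointwise : ∀ u → lookup ((τ ∪ e) ∩ y) u ≡ lookup (e ∩ y) u
    pointwise u rewrite lookup-∩ (τ ∪ e) y u | lookup-∩ e y u | lookup-∪ τ e u with lookup τ u in τu
    ... | true rewrite τ-avoids-y u τu = sym (∧-zeroʳ (lookup e u))
    ... | false = refl

module SubsetCounting where

  open import Defs using (allSubsets; count)
  open import Data.Nat using (suc; _+_; _≤_; z≤n; s≤s)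
  open import Data.Nat.Properties using (+-comm; m≤n⇒m≤1+n)
  open import Data.Bool using (Bool; true; false; T)
  open import Data.Empty using (⊥-elim)
  open import Data.List using ([]; _∷_; _++_; map; length; filterᵇ)
  open import Data.Vec using () renaming ([] to []ᵥ; _∷_ to _∷ᵥ_)
  open import Data.Fin.Subset using (Subset)
  open import Relation.Binary.PropositionalEquality
  open SubsetAlgebra using (_⊕_)

  length-filter-++ : ∀ {A : Set} (p : A → Bool) xs ys →
    length (filterᵇ p (xs ++ ys)) ≡ length (filterᵇ p xs) + length (filterᵇ p ys)
  length-filter-++ p [] ys = refl
  length-filter-++ p (x ∷ xs) ys with p x
  ... | true  = cong suc (length-filter-++ p xs ys)
  ... | false = length-filter-++ p xs ys

  length-filter-map : ∀ {A B : Set} (p : B → Bool) (f : A → B) xs →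
    length (filterᵇ p (map f xs)) ≡ length (filterᵇ (λ x → p (f x)) xs)
  length-filter-map p f [] = refl
  length-filter-map p f (x ∷ xs) with p (f x)
  ... | true  = cong suc (length-filter-map p f xs)
  ... | false = length-filter-map p f xs

  length-filter-mono : ∀ {A : Set} (p q : A → Bool) → (∀ x → T (p x) → T (q x)) → ∀ xs →
    length (filterᵇ p xs) ≤ length (filterᵇ q xs)
  length-filter-mono p q p⇒q [] = z≤n
  length-filter-mono p q p⇒q (x ∷ xs) with p x in px | q x in qx
  ... | true  | true  = s≤s (length-filter-mono p q p⇒q xs)
  ... | false | true  = m≤n⇒m≤1+n (length-filter-mono p q p⇒q xs)
  ... | false | false = length-filter-mono p q p⇒q xs
  ... | true  | false = ⊥-elim (subst T qx (p⇒q x (subst T (sym px) _)))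

  count-mono : ∀ {n} (p q : Subset n → Bool) → (∀ s → T (p s) → T (q s)) → count p ≤ count q
  count-mono {n} p q p⇒q = length-filter-mono p q p⇒q (allSubsets n)

  count-split : ∀ {n} (p : Subset (suc n) → Bool) →
    count p ≡ count (λ s → p (true ∷ᵥ s)) + count (λ s → p (false ∷ᵥ s))
  count-split {n} p = trans
    (length-filter-++ p (map (true ∷ᵥ_) (allSubsets n)) (map (false ∷ᵥ_) (allSubsets n)))
    (cong₂ _+_ (length-filter-map p (true ∷ᵥ_) (allSubsets n))
               (length-filter-map p (false ∷ᵥ_) (allSubsets n)))

  -- s ↦ s ⊕ τ permutes the subsets, so it does not change counts
  count-⊕ : ∀ {n} (τ : Subset n) (p : Subset n → Bool) → count (λ s → p (s ⊕ τ)) ≡ count p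
  count-⊕ []ᵥ p with p []ᵥ
  ... | true  = refl
  ... | false = refl
  count-⊕ (true ∷ᵥ τ) p = begin
    count (λ s → p (s ⊕ (true ∷ᵥ τ)))
      ≡⟨ count-split (λ s → p (s ⊕ (true ∷ᵥ τ))) ⟩
    count (λ s → p (false ∷ᵥ s ⊕ τ)) + count (λ s → p (true ∷ᵥ s ⊕ τ))
      ≡⟨ cong₂ _+_ (count-⊕ τ (λ s → p (false ∷ᵥ s))) (count-⊕ τ (λ s → p (true ∷ᵥ s))) ⟩
    count (λ s → p (false ∷ᵥ s)) + count (λ s → p (true ∷ᵥ s))
      ≡⟨ +-comm (count (λ s → p (false ∷ᵥ s))) _ ⟩
    count (λ s → p (true ∷ᵥ s)) + count (λ s → p (false ∷ᵥ s))
      ≡⟨ count-split p ⟨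
    count p ∎
    where open ≡-Reasoning
  count-⊕ (false ∷ᵥ τ) p = begin
    count (λ s → p (s ⊕ (false ∷ᵥ τ)))
      ≡⟨ count-split (λ s → p (s ⊕ (false ∷ᵥ τ))) ⟩
    count (λ s → p (true ∷ᵥ s ⊕ τ)) + count (λ s → p (false ∷ᵥ s ⊕ τ))
      ≡⟨ cong₂ _+_ (count-⊕ τ (λ s → p (true ∷ᵥ s))) (count-⊕ τ (λ s → p (false ∷ᵥ s))) ⟩
    count (λ s → p (true ∷ᵥ s)) + count (λ s → p (false ∷ᵥ s))
      ≡⟨ count-split p ⟨
    count p ∎
    where open ≡-Reasoning

module Rank where

  open import Data.Nat using (ℕ; zero; suc; _<_; z≤n; s≤s)
  open import Data.Nat.Properties using (suc-injective)
  open import Data.Bool using (true; false)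
  open import Data.Fin using (Fin; zero; suc)
  open import Data.Fin.Subset using (Subset; ∣_∣)
  open import Data.Vec using (_∷_; lookup)
  open import Data.Product using (∃; _×_; _,_)
  open import Relation.Binary.PropositionalEquality

  rank : ∀ {n} → Subset n → Fin n → ℕ
  rank (_ ∷ τ)     zero    = 0
  rank (true ∷ τ)  (suc v) = suc (rank τ v)
  rank (false ∷ τ) (suc v) = rank τ v

  rank-< : ∀ {n} (τ : Subset n) v → lookup τ v ≡ true → rank τ v < ∣ τ ∣
  rank-< (true ∷ τ)  zero    _  = s≤s z≤n
  rank-< (true ∷ τ)  (suc v) τv = s≤s (rank-< τ v τv)
  rank-< (false ∷ τ) (suc v) τv = rank-< τ v τv

  rank-surjective : ∀ {n} (τ : Subset n) i → i < ∣ τ ∣ → ∃ λ v → lookup τ v ≡ true × rank τ v ≡ i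
  rank-surjective (true ∷ τ) zero _ = zero , refl , refl
  rank-surjective (true ∷ τ) (suc i) (s≤s i<) with rank-surjective τ i i<
  ... | v , τv , rv = suc v , τv , cong suc rv
  rank-surjective (false ∷ τ) i i< with rank-surjective τ i i<
  ... | v , τv , rv = suc v , τv , rv

  rank-injective : ∀ {n} (τ : Subset n) u v → lookup τ u ≡ true → lookup τ v ≡ true
    → rank τ u ≡ rank τ v → u ≡ v
  rank-injective (_ ∷ τ)     zero    zero    _  _  _  = refl
  rank-injective (true ∷ τ)  zero    (suc v) _  _  ()
  rank-injective (true ∷ τ)  (suc u) zero    _  _  ()
  rank-injective (true ∷ τ)  (suc u) (suc v) τu τv r =
    cong suc (rank-injective τ u v τu τv (suc-injective r))
  rank-injective (false ∷ τ) (suc u) (suc v) τu τv r = cong suc (rank-injective τ u v τu τv r)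

module Fibres where

  open import Defs using (IsPartition)
  open import Data.Nat using (ℕ; suc; _<_; _≡ᵇ_)
  open import Data.Nat.Properties using (≡ᵇ⇒≡; ≡⇒≡ᵇ)
  open import Data.Bool using (true)
  open import Data.Bool.Properties using (T-≡)
  open import Data.Fin using (Fin; toℕ; fromℕ<)
  open import Data.Fin.Properties using (toℕ-injective; toℕ-fromℕ<)
  open import Data.Fin.Subset using (Subset; _∩_; _∈_; Nonempty; Empty)
  open import Data.Fin.Subset.Properties using (x∈p∩q⁻)
  open import Data.Vec using (lookup; tabulate)
  open import Data.Vec.Properties using (lookup∘tabulate; []=⇒lookup; lookup⇒[]=)
  open import Data.Product using (∃; _,_)
  open import Function using (Equivalence)
  open import Relation.Binary.PropositionalEquality

  fibre : ∀ {n} → (Fin n → ℕ) → ℕ → Subset n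
  fibre label i = tabulate (λ u → label u ≡ᵇ i)

  lookup-fibre : ∀ {n} (label : Fin n → ℕ) i u → lookup (fibre label i) u ≡ (label u ≡ᵇ i)
  lookup-fibre label i u = lookup∘tabulate (λ v → label v ≡ᵇ i) u

  ∈fibre⁺ : ∀ {n} (label : Fin n → ℕ) {i u} → label u ≡ i → lookup (fibre label i) u ≡ true
  ∈fibre⁺ label {i} {u} lu =
    trans (lookup-fibre label i u) (Equivalence.to T-≡ (≡⇒≡ᵇ (label u) i lu))

  ∈fibre⁻ : ∀ {n} (label : Fin n → ℕ) {i u} → lookup (fibre label i) u ≡ true → label u ≡ i
  ∈fibre⁻ label {i} {u} u∈ =
    ≡ᵇ⇒≡ (label u) i (Equivalence.from T-≡ (trans (sym (lookup-fibre label i u)) u∈))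

  fibres-partition : ∀ {n} (d : ℕ) (label : Fin n → ℕ) → (∀ u → label u < suc d)
    → (∀ (i : Fin (suc d)) → ∃ λ u → label u ≡ toℕ i)
    → IsPartition d (λ i → fibre label (toℕ i))
  fibres-partition d label bounded onto = nonempty , disjoint , covering
    where
    part : Fin (suc d) → Subset _
    part i = fibre label (toℕ i)
    nonempty : ∀ i → Nonempty (part i)
    nonempty i with onto i
    ... | u , lu = u , lookup⇒[]= u (part i) (∈fibre⁺ label lu)
    disjoint : ∀ i j → i ≢ j → Empty (part i ∩ part j)
    disjoint i j i≢j (u , u∈i∩j) with x∈p∩q⁻ (part i) (part j) u∈i∩j
    ... | u∈i , u∈j = i≢j (toℕ-injective
      (trans (sym (∈fibre⁻ label ([]=⇒lookup u∈i))) (∈fibre⁻ label ([]=⇒lookup u∈j))))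
    covering : ∀ u → ∃ λ i → u ∈ part i
    covering u = fromℕ< (bounded u) ,
      lookup⇒[]= u (part _) (∈fibre⁺ label (sym (toℕ-fromℕ< (bounded u))))

module PartSizes where

  open import Defs using (prodSizes)
  open import Data.Nat using (ℕ; suc; _*_)
  open import Data.Nat.Properties using (*-identityʳ)
  open import Data.Nat.ListAction using (product)
  open import Data.Fin using (Fin; zero; suc)
  open import Data.Fin.Subset using (Subset; ∣_∣)
  open import Data.List using (map; tabulate)
  open import Relation.Binary.PropositionalEquality

  product-of-ones : ∀ {m d} (g : Fin d → ℕ) (h : Fin m → Fin d) → (∀ j → g (h j) ≡ 1)
    → product (map g (tabulate h)) ≡ 1
  product-of-ones {ℕ.zero} g h ones = refl
  product-of-ones {suc m} g h ones =
    cong₂ _*_ (ones zero) (product-of-ones g (λ j → h (suc j)) (λ j → ones (suc j)))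

  prodSizes-two-parts : ∀ {n} k (A : Fin (suc (suc k)) → Subset n)
    → (∀ j → ∣ A (suc (suc j)) ∣ ≡ 1) → prodSizes (suc k) A ≡ ∣ A zero ∣ * ∣ A (suc zero) ∣
  prodSizes-two-parts k A singletons = trans
    (cong (λ r → ∣ A zero ∣ * (∣ A (suc zero) ∣ * r))
          (product-of-ones (λ i → ∣ A i ∣) (λ j → suc (suc j)) singletons))
    (cong (∣ A zero ∣ *_) (*-identityʳ ∣ A (suc zero) ∣))

module NaturalsInℚ where

  open import Defs using (ℚ[_])
  open import Data.Nat using (ℕ; suc)
  import Data.Nat as ℕ
  import Data.Nat.Properties as ℕ
  open import Data.Nat.Coprimality using (1-coprimeTo; sym)
  open import Data.Integer using (+_)
  import Data.Integer as ℤ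
  import Data.Integer.Properties as ℤ
  open import Data.Rational using (mkℚ; 0ℚ; _/_; _*_; _+_; _-_; -_; _≤_; *≤*; NonNegative; Positive)
  open import Data.Rational.Properties using (normalize-coprime; +-assoc; +-inverseʳ; +-identityʳ)
  open import Relation.Binary.PropositionalEquality hiding (sym)
  import Relation.Binary.PropositionalEquality as Eq

  ℚ[]-mkℚ : ∀ m → ℚ[ m ] ≡ mkℚ (+ m) 0 (sym (1-coprimeTo m))
  ℚ[]-mkℚ m = normalize-coprime (sym (1-coprimeTo m))

  ℚ[]-* : ∀ a b → ℚ[ a ] * ℚ[ b ] ≡ ℚ[ a ℕ.* b ]
  ℚ[]-* a b rewrite ℚ[]-mkℚ a | ℚ[]-mkℚ b = cong (_/ 1) (ℤ.+◃n≡+n (a ℕ.* b))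

  ℚ[]-+ : ∀ a b → ℚ[ a ] + ℚ[ b ] ≡ ℚ[ a ℕ.+ b ]
  ℚ[]-+ a b rewrite ℚ[]-mkℚ a | ℚ[]-mkℚ b | ℕ.*-identityʳ a | ℕ.*-identityʳ b
                  | ℤ.+◃n≡+n a | ℤ.+◃n≡+n b = cong (_/ 1) (Eq.sym (ℤ.pos-+ a b))

  ℚ[]-mono-≤ : ∀ {a b} → a ℕ.≤ b → ℚ[ a ] ≤ ℚ[ b ]
  ℚ[]-mono-≤ {a} {b} a≤b rewrite ℚ[]-mkℚ a | ℚ[]-mkℚ b =
    *≤* (subst₂ ℤ._≤_ (Eq.sym (ℤ.*-identityʳ (+ a))) (Eq.sym (ℤ.*-identityʳ (+ b))) (ℤ.+≤+ a≤b))

  ℚ[]-∸ : ∀ m k → ℚ[ m ℕ.+ k ] - ℚ[ k ] ≡ ℚ[ m ]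
  ℚ[]-∸ m k = begin
    ℚ[ m ℕ.+ k ] - ℚ[ k ]         ≡⟨ cong (_- ℚ[ k ]) (ℚ[]-+ m k) ⟨
    (ℚ[ m ] + ℚ[ k ]) - ℚ[ k ]    ≡⟨ +-assoc ℚ[ m ] ℚ[ k ] (- ℚ[ k ]) ⟩
    ℚ[ m ] + (ℚ[ k ] - ℚ[ k ])    ≡⟨ cong (λ x → ℚ[ m ] + x) (+-inverseʳ ℚ[ k ]) ⟩
    ℚ[ m ] + 0ℚ                   ≡⟨ +-identityʳ ℚ[ m ] ⟩
    ℚ[ m ]                        ∎
    where open ≡-Reasoning

  ℚ[]-nonNeg : ∀ a → NonNegative ℚ[ a ]
  ℚ[]-nonNeg a rewrite ℚ[]-mkℚ a = _

  ℚ[]-pos : ∀ a → Positive ℚ[ suc a ]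
  ℚ[]-pos a rewrite ℚ[]-mkℚ (suc a) = _

module CheegerArithmetic where

  open import Defs using (ℚ[_])
  open import Data.Nat using (ℕ; suc; z≤n; s≤s)
  import Data.Nat as ℕ
  import Data.Nat.Properties as ℕ
  open import Data.Nat.Tactic.RingSolver using (solve-∀)
  open import Data.Rational using (ℚ; 0ℚ; _*_; _-_; _≤_; _≤?_; NonNegative; Positive; nonNegative)
  open import Data.Rational.Properties
  open import Relation.Nullary using (yes; no)
  open import Relation.Binary.PropositionalEquality
  open NaturalsInℚ

  -- clearing denominators in (a+c)/(c·a) ≤ (b+c)/(b·c), which holds as b ≤ a
  cut-size-bound : ∀ a b c → b ℕ.≤ a → (a ℕ.+ c) ℕ.* (b ℕ.* c) ℕ.≤ (c ℕ.* a) ℕ.* (b ℕ.+ c)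
  cut-size-bound a b c b≤a = begin
    (a ℕ.+ c) ℕ.* (b ℕ.* c)           ≡⟨ expand-left a b c ⟩
    c ℕ.* a ℕ.* b ℕ.+ c ℕ.* b ℕ.* c   ≤⟨ ℕ.+-monoʳ-≤ (c ℕ.* a ℕ.* b) (ℕ.*-monoˡ-≤ c (ℕ.*-monoʳ-≤ c b≤a)) ⟩
    c ℕ.* a ℕ.* b ℕ.+ c ℕ.* a ℕ.* c   ≡⟨ expand-right a b c ⟨
    (c ℕ.* a) ℕ.* (b ℕ.+ c)           ∎
    where
    open ℕ.≤-Reasoning
    expand-left : ∀ a b c → (a ℕ.+ c) ℕ.* (b ℕ.* c) ≡ c ℕ.* a ℕ.* b ℕ.+ c ℕ.* b ℕ.* c
    expand-left = solve-∀
    expand-right : ∀ a b c → (c ℕ.* a) ℕ.* (b ℕ.+ c) ≡ c ℕ.* a ℕ.* b ℕ.+ c ℕ.* a ℕ.* c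
    expand-right = solve-∀

  nonNeg-if-multiple : ∀ (q : ℚ) m x → q * ℚ[ suc m ] ≡ ℚ[ x ] → 0ℚ ≤ q
  nonNeg-if-multiple q m x q·m≡x = *-cancelʳ-≤-pos ℚ[ suc m ] {{ℚ[]-pos m}}
    (subst (_≤ q * ℚ[ suc m ]) (sym (*-zeroˡ ℚ[ suc m ]))
      (subst (0ℚ ≤_) (sym q·m≡x) (nonNegative⁻¹ ℚ[ x ] {{ℚ[]-nonNeg x}})))

  -- the inequality itself, for a = |A₁|, b = |B|, c = |C| = |A₀|, w = |W|, P = |A₀|⋯|A_d|,
  -- F = |F(A)|, E = |E(B,C)|, given minimality of h(X) on A and h(lk τ) attained at (B, C)
  cheeger-comparison : ∀ {n k a b c w P F E : ℕ} (hX hL : ℚ)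
    → n ≡ a ℕ.+ c ℕ.+ k → w ≡ b ℕ.+ c → P ≡ c ℕ.* a
    → 1 ℕ.≤ b → 1 ℕ.≤ c → b ℕ.≤ a → F ℕ.≤ E
    → hX * ℚ[ P ] ≤ ℚ[ n ℕ.* F ] → hL * ℚ[ b ℕ.* c ] ≡ ℚ[ w ℕ.* E ]
    → hX * (ℚ[ n ] - ℚ[ k ]) ≤ hL * ℚ[ n ]
  cheeger-comparison {n} {k} {a} {suc b′} {suc c′} {w} {F = F} {E} hX hL
                     refl refl refl (s≤s z≤n) (s≤s z≤n) b≤a F≤E hX-bound hL-value =
    subst (λ z → hX * z ≤ hL * ℚ[ n ]) (sym (ℚ[]-∸ (a ℕ.+ c) k)) bound
    where
    b c bc : ℕ
    b = suc b′
    c = suc c′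
    bc = b ℕ.* c
    instance
      bc-pos : Positive ℚ[ bc ]
      bc-pos = ℚ[]-pos (c′ ℕ.+ b′ ℕ.* c)
      n-nonNeg : NonNegative ℚ[ n ]
      n-nonNeg = ℚ[]-nonNeg n
      a+c-nonNeg : NonNegative ℚ[ a ℕ.+ c ]
      a+c-nonNeg = ℚ[]-nonNeg (a ℕ.+ c)
      w-nonNeg : NonNegative ℚ[ w ]
      w-nonNeg = ℚ[]-nonNeg w

    hL·n≥0 : 0ℚ ≤ hL * ℚ[ n ]
    hL·n≥0 = subst (_≤ hL * ℚ[ n ]) (*-zeroˡ ℚ[ n ])
      (*-monoʳ-≤-nonNeg ℚ[ n ] (nonNeg-if-multiple hL (c′ ℕ.+ b′ ℕ.* c) (w ℕ.* E) hL-value))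

    scaled : NonNegative hX → hX * ℚ[ a ℕ.+ c ] * ℚ[ bc ] ≤ hL * ℚ[ n ] * ℚ[ bc ]
    scaled hX-nonNeg = begin
      hX * ℚ[ a ℕ.+ c ] * ℚ[ bc ]    ≡⟨ trans (*-assoc hX _ _) (cong (hX *_) (ℚ[]-* (a ℕ.+ c) bc)) ⟩
      hX * ℚ[ (a ℕ.+ c) ℕ.* bc ]     ≤⟨ *-monoˡ-≤-nonNeg hX {{hX-nonNeg}} (ℚ[]-mono-≤ (cut-size-bound a b c b≤a)) ⟩
      hX * ℚ[ c ℕ.* a ℕ.* w ]        ≡⟨ trans (cong (hX *_) (sym (ℚ[]-* (c ℕ.* a) w))) (sym (*-assoc hX _ _)) ⟩
      hX * ℚ[ c ℕ.* a ] * ℚ[ w ]     ≤⟨ *-monoʳ-≤-nonNeg ℚ[ w ] hX-bound ⟩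
      ℚ[ n ℕ.* F ] * ℚ[ w ]          ≤⟨ *-monoʳ-≤-nonNeg ℚ[ w ] (ℚ[]-mono-≤ (ℕ.*-monoʳ-≤ n F≤E)) ⟩
      ℚ[ n ℕ.* E ] * ℚ[ w ]          ≡⟨ trans (ℚ[]-* (n ℕ.* E) w) (cong ℚ[_] (regroup n E w)) ⟩
      ℚ[ n ℕ.* (w ℕ.* E) ]           ≡⟨ trans (sym (ℚ[]-* n (w ℕ.* E))) (cong (ℚ[ n ] *_) (sym hL-value)) ⟩
      ℚ[ n ] * (hL * ℚ[ bc ])        ≡⟨ trans (sym (*-assoc ℚ[ n ] hL ℚ[ bc ])) (cong (_* ℚ[ bc ]) (*-comm ℚ[ n ] hL)) ⟩
      hL * ℚ[ n ] * ℚ[ bc ]          ∎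
      where
      open ≤-Reasoning
      regroup : ∀ n E w → n ℕ.* E ℕ.* w ≡ n ℕ.* (w ℕ.* E)
      regroup = solve-∀

    bound : hX * ℚ[ a ℕ.+ c ] ≤ hL * ℚ[ n ]
    bound with hX ≤? 0ℚ
    ... | yes hX≤0 = ≤-trans
      (subst (hX * ℚ[ a ℕ.+ c ] ≤_) (*-zeroˡ ℚ[ a ℕ.+ c ]) (*-monoʳ-≤-nonNeg ℚ[ a ℕ.+ c ] hX≤0))
      hL·n≥0
    ... | no hX≰0 = *-cancelʳ-≤-pos ℚ[ bc ] (scaled (nonNegative (<⇒≤ (≰⇒> hX≰0))))

-- Given τ with |τ| = k and a cut W = B ⊔ C of the link vertices of τ, the partition of V into
--   A₀ = C,  A₁ = V ∖ (C ∪ τ) ⊇ B,  A₂₊ⱼ = {j-th vertex of τ}  (j < k)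
-- has |A₀|⋯|A_{k+1}| = |C|·|A₁|, and its rainbow (k+1)-cells correspond to B–C edges of lk τ
module LinkCut (n k : ℕ) (X : SimplicialComplex n) (τ B C : Subset n) (τ-size : ∣ τ ∣ ≡ k)
               (B∪C≡W : B ∪ C ≡ linkVertices X τ) (B∩C≡∅ : Empty (B ∩ C)) where

  open import Data.Nat using (suc; _+_; _*_; _<_; _≤_; _≡ᵇ_; z≤n; s≤s)
  open import Data.Nat.Properties using (suc-injective; +-comm; +-cancelˡ-≡; ≡ᵇ⇒≡; ≡⇒≡ᵇ)
  open import Data.Bool using (Bool; true; false; T; not; _∧_; _∨_; if_then_else_)
  open import Data.Bool.Properties using (T-≡; T-∧; ∨-conicalˡ; ∨-conicalʳ; ∨-identityʳ; ∨-zeroʳ; ∨-inverseˡ)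
  open import Data.Bool.ListAction using (all)
  open import Data.Fin using (Fin; zero; suc; toℕ; fromℕ<)
  open import Data.Fin.Properties using (toℕ<n; toℕ-fromℕ<)
  open import Data.Fin.Subset using (⁅_⁆; ⊤; _⊆_; Nonempty)
  open import Data.Fin.Subset.Properties using (∣⊤∣≡n; ∣⁅x⁆∣≡1; x∈⁅y⁆⇒x≡y; x∈p∪q⁺; x∈p∪q⁻)
  open import Data.Vec using (lookup)
  open import Data.Vec.Properties using (lookup∘tabulate; lookup-replicate; []=⇒lookup; lookup⇒[]=)
  open import Data.List using (allFin)
  import Data.List.Relation.Unary.All as All
  open import Data.List.Relation.Unary.All.Properties using (all⁺)
  open import Data.List.Membership.Propositional.Properties using (∈-allFin)
  open import Data.Product using (∃; _×_; _,_; proj₁; proj₂)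
  open import Data.Sum using (inj₁; inj₂)
  open import Data.Empty using (⊥-elim)
  open import Function using (Equivalence)
  open import Relation.Nullary using (contradiction)
  open import Relation.Binary.PropositionalEquality
  open SubsetAlgebra
  open SubsetCounting using (count-mono; count-⊕)
  open Rank
  open Fibres
  open PartSizes using (prodSizes-two-parts)

  W : Subset n
  W = linkVertices X τ

  lookup-W : ∀ u → lookup W u ≡ not (lookup τ u) ∧ cell X (τ ∪ ⁅ u ⁆)
  lookup-W u = lookup∘tabulate (λ v → not (lookup τ v) ∧ cell X (τ ∪ ⁅ v ⁆)) u

  lookup-B∨C : ∀ u → lookup B u ∨ lookup C u ≡ lookup W u
  lookup-B∨C u = trans (sym (lookup-∪ B C u)) (cong (λ s → lookup s u) B∪C≡W)

  τ-avoids-W : Disjoint τ W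
  τ-avoids-W u τu = trans (lookup-W u) (cong (λ t → not t ∧ cell X (τ ∪ ⁅ u ⁆)) τu)

  τ-avoids-B : Disjoint τ B
  τ-avoids-B u τu = ∨-conicalˡ _ _ (trans (lookup-B∨C u) (τ-avoids-W u τu))

  τ-avoids-C : Disjoint τ C
  τ-avoids-C u τu = ∨-conicalʳ _ _ (trans (lookup-B∨C u) (τ-avoids-W u τu))

  B-avoids-C : Disjoint B C
  B-avoids-C u bu with lookup C u in cu
  ... | false = refl
  ... | true  = ⊥-elim (B∩C≡∅ (u , lookup⇒[]= u (B ∩ C) (trans (lookup-∩ B C u) (cong₂ _∧_ bu cu))))

  B-on-W : ∀ u → lookup W u ≡ true → lookup B u ≡ not (lookup C u)
  B-on-W u wu with lookup C u in cu
  ... | false = trans (sym (∨-identityʳ (lookup B u)))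
                  (trans (cong (lookup B u ∨_) (sym cu)) (trans (lookup-B∨C u) wu))
  ... | true with lookup B u in bu
  ...   | false = refl
  ...   | true  = trans (sym cu) (B-avoids-C u bu)

  label : Fin n → ℕ
  label u = if lookup τ u then 2 + rank τ u else (if lookup C u then 0 else 1)

  label-τ : ∀ u → lookup τ u ≡ true → label u ≡ 2 + rank τ u
  label-τ u τu rewrite τu = refl

  label-C : ∀ u → lookup τ u ≡ false → lookup C u ≡ true → label u ≡ 0
  label-C u τu cu rewrite τu | cu = refl

  label-rest : ∀ u → lookup τ u ≡ false → lookup C u ≡ false → label u ≡ 1
  label-rest u τu cu rewrite τu | cu = refl

  A : Fin (suc (suc k)) → Subset n
  A i = fibre label (toℕ i)

  A₀ A₁ : Subset n
  A₀ = A zero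
  A₁ = A (suc zero)

  τ-vertex-spec : (j : Fin k) → ∃ λ v → lookup τ v ≡ true × rank τ v ≡ toℕ j
  τ-vertex-spec j = rank-surjective τ (toℕ j) (subst (toℕ j <_) (sym τ-size) (toℕ<n j))

  τ-vertex : Fin k → Fin n
  τ-vertex j = proj₁ (τ-vertex-spec j)

  τ-vertex-∈ : ∀ j → lookup τ (τ-vertex j) ≡ true
  τ-vertex-∈ j = proj₁ (proj₂ (τ-vertex-spec j))

  τ-vertex-rank : ∀ j → rank τ (τ-vertex j) ≡ toℕ j
  τ-vertex-rank j = proj₂ (proj₂ (τ-vertex-spec j))

  τ-vertex-label : ∀ j → label (τ-vertex j) ≡ 2 + toℕ j
  τ-vertex-label j = trans (label-τ _ (τ-vertex-∈ j)) (cong (2 +_) (τ-vertex-rank j))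

  A-τ-part : ∀ j → A (suc (suc j)) ≡ ⁅ τ-vertex j ⁆
  A-τ-part j = singleton-ext (A (suc (suc j))) (τ-vertex j) (∈fibre⁺ label (τ-vertex-label j)) only
    where
    only : ∀ u → lookup (A (suc (suc j))) u ≡ true → u ≡ τ-vertex j
    only u u∈ with lookup τ u in τu | lookup C u in cu
    ... | true  | _     = rank-injective τ u (τ-vertex j) τu (τ-vertex-∈ j) (trans
      (suc-injective (suc-injective (trans (sym (label-τ u τu)) (∈fibre⁻ label u∈))))
      (sym (τ-vertex-rank j)))
    ... | false | true  = contradiction (trans (sym (label-C u τu cu)) (∈fibre⁻ label u∈)) λ ()
    ... | false | false = contradiction (trans (sym (label-rest u τu cu)) (∈fibre⁻ label u∈)) λ ()

  label-bounded : ∀ u → label u < 2 + k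
  label-bounded u with lookup τ u in τu | lookup C u in cu
  ... | true  | _     = s≤s (s≤s (subst (rank τ u <_) τ-size (rank-< τ u τu)))
  ... | false | true  = s≤s z≤n
  ... | false | false = s≤s (s≤s z≤n)

  label-onto : Nonempty B → Nonempty C → ∀ (i : Fin (2 + k)) → ∃ λ u → label u ≡ toℕ i
  label-onto _ (c , c∈C) zero =
    c , label-C c (disjoint-sym τ C τ-avoids-C c ([]=⇒lookup c∈C)) ([]=⇒lookup c∈C)
  label-onto (b , b∈B) _ (suc zero) =
    b , label-rest b (disjoint-sym τ B τ-avoids-B b ([]=⇒lookup b∈B)) (B-avoids-C b ([]=⇒lookup b∈B))
  label-onto _ _ (suc (suc j)) = τ-vertex j , τ-vertex-label j

  A-partition : Nonempty B → Nonempty C → IsPartition (suc k) A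
  A-partition B≢∅ C≢∅ = fibres-partition (suc k) label label-bounded (label-onto B≢∅ C≢∅)

  τ-avoids-A₀ : Disjoint τ A₀
  τ-avoids-A₀ u τu = trans (lookup-fibre label 0 u) (cong (_≡ᵇ 0) (label-τ u τu))

  τ-avoids-A₁ : Disjoint τ A₁
  τ-avoids-A₁ u τu = trans (lookup-fibre label 1 u) (cong (_≡ᵇ 1) (label-τ u τu))

  A₀-off-τ : ∀ u → lookup τ u ≡ false → lookup A₀ u ≡ lookup C u
  A₀-off-τ u τu with lookup C u in cu
  ... | true  = ∈fibre⁺ label (label-C u τu cu)
  ... | false = trans (lookup-fibre label 0 u) (cong (_≡ᵇ 0) (label-rest u τu cu))

  A₁-off-τ : ∀ u → lookup τ u ≡ false → lookup A₁ u ≡ not (lookup C u)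
  A₁-off-τ u τu with lookup C u in cu
  ... | true  = trans (lookup-fibre label 1 u) (cong (_≡ᵇ 1) (label-C u τu cu))
  ... | false = ∈fibre⁺ label (label-rest u τu cu)

  A₀≡C : A₀ ≡ C
  A₀≡C = subset-ext A₀ C pointwise
    where
    pointwise : ∀ u → lookup A₀ u ≡ lookup C u
    pointwise u with lookup τ u in τu
    ... | true  = trans (τ-avoids-A₀ u τu) (sym (τ-avoids-C u τu))
    ... | false = A₀-off-τ u τu

  B⊆A₁ : B ⊆ A₁
  B⊆A₁ = ⊆-from-lookup λ u bu →
    trans (A₁-off-τ u (disjoint-sym τ B τ-avoids-B u bu)) (cong not (B-avoids-C u bu))

  C-avoids-A₁ : Disjoint C A₁
  C-avoids-A₁ u cu = trans (A₁-off-τ u (disjoint-sym τ C τ-avoids-C u cu)) (cong not cu)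

  τ-avoids-A₁∪C : Disjoint τ (A₁ ∪ C)
  τ-avoids-A₁∪C u τu = trans (lookup-∪ A₁ C u) (cong₂ _∨_ (τ-avoids-A₁ u τu) (τ-avoids-C u τu))

  V-decomposition : ⊤ ≡ (A₁ ∪ C) ∪ τ
  V-decomposition = subset-ext ⊤ ((A₁ ∪ C) ∪ τ) pointwise
    where
    pointwise : ∀ u → lookup ⊤ u ≡ lookup ((A₁ ∪ C) ∪ τ) u
    pointwise u rewrite lookup-replicate u true | lookup-∪ (A₁ ∪ C) τ u | lookup-∪ A₁ C u
      with lookup τ u in τu
    ... | true  = sym (∨-zeroʳ _)
    ... | false rewrite A₁-off-τ u τu = sym (trans (∨-identityʳ _) (∨-inverseˡ (lookup C u)))

  vertex-count : n ≡ ∣ A₁ ∣ + ∣ C ∣ + k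
  vertex-count = begin
    n                    ≡⟨ ∣⊤∣≡n n ⟨
    ∣ ⊤ {n} ∣            ≡⟨ cong ∣_∣ V-decomposition ⟩
    ∣ (A₁ ∪ C) ∪ τ ∣     ≡⟨ card-disjoint-∪ (A₁ ∪ C) τ (disjoint-sym τ (A₁ ∪ C) τ-avoids-A₁∪C) ⟩
    ∣ A₁ ∪ C ∣ + ∣ τ ∣   ≡⟨ cong₂ _+_ (card-disjoint-∪ A₁ C (disjoint-sym C A₁ C-avoids-A₁)) τ-size ⟩
    ∣ A₁ ∣ + ∣ C ∣ + k   ∎
    where open ≡-Reasoning

  link-size : ∣ W ∣ ≡ ∣ B ∣ + ∣ C ∣
  link-size = trans (cong ∣_∣ (sym B∪C≡W)) (card-disjoint-∪ B C B-avoids-C)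

  part-sizes : prodSizes (suc k) A ≡ ∣ C ∣ * ∣ A₁ ∣
  part-sizes = trans (prodSizes-two-parts k A (λ j → trans (cong ∣_∣ (A-τ-part j)) (∣⁅x⁆∣≡1 (τ-vertex j))))
                     (cong (λ s → ∣ s ∣ * ∣ A₁ ∣) A₀≡C)

  inF : Subset n → Bool
  inF σ = cell X σ ∧ (∣ σ ∣ ≡ᵇ 2 + k) ∧ all (λ i → ∣ σ ∩ A i ∣ ≡ᵇ 1) (allFin (2 + k))

  inE : Subset n → Bool
  inE e = isLinkEdge X τ e ∧ (∣ e ∩ B ∣ ≡ᵇ 1) ∧ (∣ e ∩ C ∣ ≡ᵇ 1)

  record RainbowCell (σ : Subset n) : Set where
    field
      is-cell : T (cell X σ)
      size    : ∣ σ ∣ ≡ 2 + k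
      rainbow : ∀ i → ∣ σ ∩ A i ∣ ≡ 1

  inF⇒rainbow : ∀ σ → T (inF σ) → RainbowCell σ
  inF⇒rainbow σ σ∈F = record
    { is-cell = σ-cell
    ; size    = ≡ᵇ⇒≡ ∣ σ ∣ (2 + k) σ-size
    ; rainbow = λ i → ≡ᵇ⇒≡ ∣ σ ∩ A i ∣ 1 (All.lookup (all⁺ part-test (allFin (2 + k)) σ-parts) (∈-allFin i))
    }
    where
    part-test : Fin (2 + k) → Bool
    part-test i = ∣ σ ∩ A i ∣ ≡ᵇ 1
    σ-cell : T (cell X σ)
    σ-cell = proj₁ (Equivalence.to (T-∧ {cell X σ}) σ∈F)
    σ-size-parts : T (∣ σ ∣ ≡ᵇ 2 + k) × T (all part-test (allFin (2 + k)))
    σ-size-parts = Equivalence.to T-∧ (proj₂ (Equivalence.to (T-∧ {cell X σ}) σ∈F))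
    σ-size : T (∣ σ ∣ ≡ᵇ 2 + k)
    σ-size = proj₁ σ-size-parts
    σ-parts : T (all part-test (allFin (2 + k)))
    σ-parts = proj₂ σ-size-parts

  -- each vertex of τ forms a part on its own, so a rainbow cell contains τ
  rainbow-contains-τ : ∀ {σ} → RainbowCell σ → ∀ u → lookup τ u ≡ true → lookup σ u ≡ true
  rainbow-contains-τ {σ} rc u τu = subst (λ v → lookup σ v ≡ true) vertex≡u
    (meets-singleton σ (τ-vertex j) (subst (λ s → ∣ σ ∩ s ∣ ≡ 1) (A-τ-part j) (rainbow rc (suc (suc j)))))
    where
    open RainbowCell
    rank<k : rank τ u < k
    rank<k = subst (rank τ u <_) τ-size (rank-< τ u τu)
    j : Fin k
    j = fromℕ< rank<k
    vertex≡u : τ-vertex j ≡ u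
    vertex≡u = rank-injective τ (τ-vertex j) u (τ-vertex-∈ j) τu
      (trans (τ-vertex-rank j) (toℕ-fromℕ< rank<k))

  -- if τ ∪ e is a cell and e avoids τ, every vertex u of e is a link vertex (τ ∪ {u} ⊆ τ ∪ e)
  edge-in-link : ∀ e → Disjoint τ e → T (cell X (τ ∪ e)) → ∀ u → lookup e u ≡ true → lookup W u ≡ true
  edge-in-link e τ-avoids-e τe-cell u eu = trans (lookup-W u)
    (cong₂ _∧_ (cong not (disjoint-sym τ e τ-avoids-e u eu)) (Equivalence.to T-≡ τu-cell))
    where
    τu⊆τe : τ ∪ ⁅ u ⁆ ⊆ τ ∪ e
    τu⊆τe x∈ with x∈p∪q⁻ τ ⁅ u ⁆ x∈
    ... | inj₁ x∈τ = x∈p∪q⁺ (inj₁ x∈τ)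
    ... | inj₂ x∈u rewrite x∈⁅y⁆⇒x≡y u x∈u = x∈p∪q⁺ (inj₂ (lookup⇒[]= u e eu))
    τu-cell : T (cell X (τ ∪ ⁅ u ⁆))
    τu-cell = down-closed X (τ ∪ e) (τ ∪ ⁅ u ⁆) τu⊆τe τe-cell

  -- a rainbow cell σ = e ⊕ τ is the disjoint union τ ∪ e, where e is an edge of lk τ
  -- meeting B and C exactly where σ meets A₁ and A₀
  module RainbowMinusτ (e : Subset n) (rc : RainbowCell (e ⊕ τ)) where

    open RainbowCell rc

    σ : Subset n
    σ = e ⊕ τ

    τ-avoids-e : Disjoint τ e
    τ-avoids-e = proj₁ (⊕-decompose e τ (rainbow-contains-τ rc))

    σ≡τ∪e : σ ≡ τ ∪ e
    σ≡τ∪e = proj₂ (⊕-decompose e τ (rainbow-contains-τ rc))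

    τe-cell : T (cell X (τ ∪ e))
    τe-cell = subst (λ s → T (cell X s)) σ≡τ∪e is-cell

    e-size : ∣ e ∣ ≡ 2
    e-size = +-cancelˡ-≡ k ∣ e ∣ 2 (begin
      k + ∣ e ∣       ≡⟨ cong (_+ ∣ e ∣) τ-size ⟨
      ∣ τ ∣ + ∣ e ∣   ≡⟨ card-disjoint-∪ τ e τ-avoids-e ⟨
      ∣ τ ∪ e ∣       ≡⟨ cong ∣_∣ σ≡τ∪e ⟨
      ∣ σ ∣           ≡⟨ size ⟩
      2 + k           ≡⟨ +-comm 2 k ⟩
      k + 2           ∎)
      where open ≡-Reasoning

    e∩τ-size : ∣ e ∩ τ ∣ ≡ 0
    e∩τ-size = disjoint-∩-empty τ e τ-avoids-e

    e-off-τ : ∀ u → lookup e u ≡ true → lookup τ u ≡ false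
    e-off-τ = disjoint-sym τ e τ-avoids-e

    σ∩≡e∩ : ∀ y → Disjoint τ y → σ ∩ y ≡ e ∩ y
    σ∩≡e∩ y τ-avoids-y = trans (cong (_∩ y) σ≡τ∪e) (∪-∩-drop τ e y τ-avoids-y)

    e∩C-size : ∣ e ∩ C ∣ ≡ 1
    e∩C-size = begin
      ∣ e ∩ C ∣    ≡⟨ cong ∣_∣ (∩-cong-on e C A₀ λ u eu → sym (A₀-off-τ u (e-off-τ u eu))) ⟩
      ∣ e ∩ A₀ ∣   ≡⟨ cong ∣_∣ (σ∩≡e∩ A₀ τ-avoids-A₀) ⟨
      ∣ σ ∩ A₀ ∣   ≡⟨ rainbow zero ⟩
      1            ∎
      where open ≡-Reasoning

    -- on e, which lies in the link, B agrees with A₁ (both are the complement of C)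
    e∩B-size : ∣ e ∩ B ∣ ≡ 1
    e∩B-size = begin
      ∣ e ∩ B ∣    ≡⟨ cong ∣_∣ (∩-cong-on e B A₁ B≡A₁-on-e) ⟩
      ∣ e ∩ A₁ ∣   ≡⟨ cong ∣_∣ (σ∩≡e∩ A₁ τ-avoids-A₁) ⟨
      ∣ σ ∩ A₁ ∣   ≡⟨ rainbow (suc zero) ⟩
      1            ∎
      where
      open ≡-Reasoning
      B≡A₁-on-e : ∀ u → lookup e u ≡ true → lookup B u ≡ lookup A₁ u
      B≡A₁-on-e u eu = trans (B-on-W u (edge-in-link e τ-avoids-e τe-cell u eu))
                             (sym (A₁-off-τ u (e-off-τ u eu)))

  ≡⇒≡ᵇ-true : ∀ {a b} → a ≡ b → (a ≡ᵇ b) ≡ true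
  ≡⇒≡ᵇ-true {a} {b} a≡b = Equivalence.to T-≡ (≡⇒≡ᵇ a b a≡b)

  rainbow-to-crossing-edge : ∀ e → T (inF (e ⊕ τ)) → T (inE e)
  rainbow-to-crossing-edge e σ∈F = Equivalence.from T-≡ (cong₂ _∧_
    (cong₂ _∧_ (≡⇒≡ᵇ-true e-size) (cong₂ _∧_ (≡⇒≡ᵇ-true e∩τ-size) (Equivalence.to T-≡ τe-cell)))
    (cong₂ _∧_ (≡⇒≡ᵇ-true e∩B-size) (≡⇒≡ᵇ-true e∩C-size)))
    where open RainbowMinusτ e (inF⇒rainbow (e ⊕ τ) σ∈F)

  -- |F(A)| ≤ |E(B,C)|: substituting σ = e ⊕ τ, every rainbow cell yields a crossing edge e
  F≤E : numF X (suc k) A ≤ numE X τ B C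
  F≤E = subst (_≤ numE X τ B C) (count-⊕ τ inF)
              (count-mono (λ e → inF (e ⊕ τ)) inE rainbow-to-crossing-edge)

open import Data.Nat using (suc; _≤_; _∸_; s≤s; z≤n)
open import Data.Bool using (T)
open import Data.Rational using (ℚ; _*_; _-_)
import Data.Rational as ℚ
open import Data.Fin.Subset.Properties using (p⊆q⇒∣p∣≤∣q∣)
open import Data.Product using (_,_)
open SubsetAlgebra using (nonempty⇒card≥1)
open CheegerArithmetic using (cheeger-comparison)

-- h(X) ≤ h(lk τ) / (1 - (d-1)/n), written as h(X) * (n - (d-1)) ≤ h(lk τ) * n
proposition4p1 : (n d : ℕ) → 1 ≤ d → (X : SimplicialComplex n) → Dimension X d
    → (τ : Subset n) → T (cell X τ) → ∣ τ ∣ ≡ d ∸ 1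
    → (hX hL : ℚ) → IsCheegerX X d hX → IsCheegerLink X τ hL
    → (hX * (ℚ[ n ] - ℚ[ d ∸ 1 ])) ℚ.≤ (hL * ℚ[ n ])
proposition4p1 n (suc k) (s≤s z≤n) X _ τ _ τ-size hX hL (_ , hX-minimal)
               ((B , C , (B≢∅ , C≢∅ , B∩C≡∅ , B∪C≡W) , hL-attained) , _) =
  cheeger-comparison hX hL vertex-count link-size part-sizes
    (nonempty⇒card≥1 B B≢∅) (nonempty⇒card≥1 C C≢∅) (p⊆q⇒∣p∣≤∣q∣ B⊆A₁) F≤E
    (hX-minimal A (A-partition B≢∅ C≢∅)) hL-attained
  where
  open LinkCut n k X τ B C τ-size B∪C≡W B∩C≡∅
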